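{- Let $\mathcal Z$ be a commutative associative unital $\mathbb Q$-algebra, $N\in\mathbb N$, $n\in[N]$, $Z=(z_{j,r})\in\mathcal Z^{N\times n}$. Let $R,S\subseteq[n]$ and $r\in[n]\setminus(R\cup S)$ (so this set is nonempty). Then $$\overline p_{R\cup\{r\}}\overline p_S-\overline p_R\overline p_{S\cup\{r\}}=\frac12\sum_{s\in[n]\setminus\{r\}}\ \sum_{(u,v)\in[N]^2_{\neq}}y_{u,v,r}\,y_{u,v,s}\sum_{\substack{j\in[N]^n_{\neq}\\ j_r=u,\,j_s=v}}\ \sum_{\substack{k\in[N]^n_{\neq}\\ k_r=u}}\big(\mathbb 1_S(s)\,p_{j,S\setminus\{s\}}\,p_{k,R}-\mathbb 1_R(s)\,p_{j,R\setminus\{s\}}\,p_{k,S}\big),$$ where for $n=1$ the right-hand side is defined to be zero.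
   Context: $[m]=\{1,\dots,m\}$. $[N]^n_{\neq}$ is the set of injective maps $j:[n]\to[N]$, written $j=(j_1,\dots,j_n)$; $[N]^2_{\neq}=\{(u,v):u\ne v\}$. For $j,k\in[N]$ and $r\in[n]$, $y_{j,k,r}=z_{j,r}-z_{k,r}$. For $R\subseteq[n]$ and an injective map $j$ from a set containing $R$ into $[N]$, $p_{j,R}=\prod_{\ell\in R}z_{j_\ell,\ell}$. For $R\subseteq[n]$, $\overline p_R=\sum_{j\in[N]^n_{\neq}}p_{j,R}$. $\mathbb 1_A$ is the indicator function of $A$. Empty sums are $0$, empty products are $1$. -}

module Defs where

open import Level using (Level; suc; _⊔_)
open import Data.Bool using (Bool; true; false; if_then_else_; _∧_; _∨_; not)
open import Data.Nat using (ℕ; zero)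
import Data.Nat as ℕ
open import Data.Fin using (Fin; _≟_)
open import Data.Fin.Subset using (Subset)
open import Data.List using (List; []; _∷_; filter; map; concatMap; allFin)
open import Data.Product using (_×_; _,_; proj₁; proj₂)
open import Data.Vec using (lookup)
import Data.Bool.ListAction as BL
open import Relation.Nullary.Decidable using (⌊_⌋; ¬?)
open import Algebra.Bundles using (CommutativeRing)
open import Algebra.Morphism.Structures using (module RingMorphisms)
open import Data.Rational using (ℚ)
open import Data.Rational.Properties using (+-*-commutativeRing)

record QAlgebra (c ℓ : Level) : Set (suc (c ⊔ ℓ)) where
  field
    cring  : CommutativeRing c ℓ
  open CommutativeRing cring public
  field
    ι      : ℚ → Carrier
    ι-hom  : RingMorphisms.IsRingHomomorphism
               (CommutativeRing.rawRing +-*-commutativeRing)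
               (CommutativeRing.rawRing cring) ι

_==_ : {N : ℕ} → Fin N → Fin N → Bool
i == j = ⌊ i ≟ j ⌋

allFuns : (n N : ℕ) → List (Fin n → Fin N)
allFuns zero      N = (λ ()) ∷ []
allFuns (ℕ.suc n) N =
  concatMap (λ a → map (λ f → λ { Fin.zero → a ; (Fin.suc i) → f i }) (allFuns n N))
            (allFin N)

isInj : {n N : ℕ} → (Fin n → Fin N) → Bool
isInj {n} f = BL.all (λ i → BL.all (λ k → (i == k) ∨ not (f i == f k)) (allFin n)) (allFin n)

injMaps : (n N : ℕ) → List (Fin n → Fin N)
injMaps n N = filter (λ f → Data.Bool._≟_ (isInj f) true) (allFuns n N)

distinctPairs : (N : ℕ) → List (Fin N × Fin N)
distinctPairs N =
  filter (λ uv → Data.Bool._≟_ (proj₁ uv == proj₂ uv) false)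
         (concatMap (λ u → map (λ v → (u , v)) (allFin N)) (allFin N))

module _ {c ℓ : Level} (𝒵 : QAlgebra c ℓ) where
  open QAlgebra 𝒵

  Σ[_]_ : {A : Set} → List A → (A → Carrier) → Carrier
  Σ[ [] ] f = 0#
  Σ[ x ∷ xs ] f = f x + Σ[ xs ] f

  Π[_]_ : {A : Set} → List A → (A → Carrier) → Carrier
  Π[ [] ] f = 1#
  Π[ x ∷ xs ] f = f x * Π[ xs ] f

  𝟙 : {n : ℕ} → Subset n → Fin n → Carrier
  𝟙 A s = if lookup A s then 1# else 0#

  module _ {N n : ℕ} (z : Fin N → Fin n → Carrier) where

    y : Fin N → Fin N → Fin n → Carrier
    y j k r = z j r - z k r

    p : (Fin n → Fin N) → Subset n → Carrier
    p j R = Π[ filter (λ l → Data.Bool._≟_ (lookup R l) true) (allFin n) ] (λ l → z (j l) l)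

    pbar : Subset n → Carrier
    pbar R = Σ[ injMaps n N ] (λ j → p j R)

module Submission where

-- Write both p̄-products as double sums over injective k and j; the left-hand side becomes
-- Σ_{k,j} p_{k,R} p_{j,S} (z_{k_r,r} − z_{j_r,r}), which changes sign when (R,k) and (S,j)
-- are exchanged, so it is half of its antisymmetrisation. In the inner sum over j, split
-- according to the value b = j_r and reindex j by the transposition τ of k_r and b, so
-- that afterwards j_r = k_r. Since j is injective and r ∉ S, on S the maps τ∘j and j differ
-- only at the position s with j_s = b, so p_{τ∘j,S} = p_{j,S} + [s ∈ S] p_{j,S∖{s}} y_{k_r,b,s}. The
-- main term p_{j,S} gives an expression symmetric under the exchange, which cancels in
-- the antisymmetrisation; the defect terms, with u = k_r = j_r and v = b, form the
-- right-hand side.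

open import Defs
open import Level using (Level)
open import Function using (_∘_; flip; Equivalence)
open import Data.Bool using (Bool; true; false; if_then_else_; _∧_; _∨_; not; T)
import Data.Bool as Bool
import Data.Bool.ListAction as BL
open import Data.Bool.Properties using (∨-identityʳ; ∨-zeroʳ; ∧-identityʳ; ∧-zeroʳ; T-≡; T-∨)
open import Data.Nat using (ℕ; _≤_)
import Data.Nat as ℕ
open import Data.Fin using (Fin; _≟_)
import Data.Fin as Fin
open import Data.Fin.Properties using (suc-injective; any?)
open import Data.Fin.Subset using (Subset; _∪_; ⁅_⁆; _∉_; _─_)
open import Data.Fin.Subset.Properties using (∪-identityʳ; p─⊥≡p)
import Data.Fin.Permutation as Permutation
open import Data.Fin.Permutation.Components using (transpose; transpose-inverse)
open import Data.List using (List; []; _∷_; _++_; map; concatMap; tabulate; filter; allFin)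
open import Data.List.Properties using (map-cong)
import Data.List.Relation.Unary.All as All
open import Data.List.Relation.Unary.All.Properties using (all⁺)
open import Data.List.Membership.Propositional.Properties using (∈-allFin)
open import Data.Vec using (lookup) renaming (_∷_ to _∷ᵛ_)
open import Data.Vec.Properties using (lookup⇒[]=)
import Data.Vec.Functional as Vector
open import Data.Product using (_×_; _,_)
open import Data.Sum using (inj₁; inj₂)
open import Data.Maybe using (Maybe; just; nothing)
open import Data.Rational using (ℚ; 0ℚ; 1ℚ; ½)
import Data.Rational as ℚ
open import Data.Rational.Properties using (+-*-commutativeRing)
open import Relation.Nullary using (yes; no; does; contradiction)
open import Relation.Nullary.Decidable using (¬?; dec-true; dec-false; isYes≗does; toWitness)
open import Relation.Unary using (Pred; Decidable)
open import Relation.Binary.PropositionalEquality as ≡ using (_≡_; _≢_; cong; cong₂)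
open import Algebra.Bundles using (CommutativeRing)
open import Algebra.Morphism.Structures using (module RingMorphisms)
open import Algebra.Solver.Ring.AlmostCommutativeRing
  using (fromCommutativeRing; _-Raw-AlmostCommutative⟶_)
import Algebra.Solver.Ring as RingSolver
import Algebra.Properties.CommutativeMonoid.Sum as CommutativeMonoidSum
import Algebra.Properties.AbelianGroup as AbelianGroupProperties
import Algebra.Properties.CommutativeSemigroup as CommutativeSemigroupProperties
import Relation.Binary.Reasoning.Setoid as SetoidReasoning

module _ {N : ℕ} where

  ==-refl : (x : Fin N) → (x == x) ≡ true
  ==-refl x = ≡.trans (isYes≗does (x ≟ x)) (dec-true (x ≟ x) ≡.refl)

  ≢⇒==-false : {x y : Fin N} → x ≢ y → (x == y) ≡ false
  ≢⇒==-false {x} {y} x≢y = ≡.trans (isYes≗does (x ≟ y)) (dec-false (x ≟ y) x≢y)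

  ==-true⇒≡ : {x y : Fin N} → (x == y) ≡ true → x ≡ y
  ==-true⇒≡ x==y = toWitness (Equivalence.from T-≡ x==y)

  ==-sym : (x y : Fin N) → (x == y) ≡ (y == x)
  ==-sym x y with x ≟ y
  ... | yes ≡.refl = ≡.sym (==-refl x)
  ... | no x≢y = ≡.sym (≢⇒==-false (x≢y ∘ ≡.sym))

==-injective : ∀ {N M} (τ : Fin N → Fin M) → (∀ {x y} → τ x ≡ τ y → x ≡ y) →
               ∀ x y → (τ x == τ y) ≡ (x == y)
==-injective τ τ-injective x y with x ≟ y
... | yes ≡.refl = ==-refl (τ x)
... | no x≢y = ≢⇒==-false (x≢y ∘ τ-injective)

suc-==-suc : ∀ {N} (x y : Fin N) → (Fin.suc x == Fin.suc y) ≡ (x == y)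
suc-==-suc = ==-injective Fin.suc suc-injective

lookup-∪-⁅⁆ : ∀ {n} (X : Subset n) (r l : Fin n) → lookup (X ∪ ⁅ r ⁆) l ≡ (lookup X l ∨ (l == r))
lookup-∪-⁅⁆ (x ∷ᵛ X) Fin.zero Fin.zero = ≡.refl
lookup-∪-⁅⁆ (x ∷ᵛ X) Fin.zero (Fin.suc l) =
  ≡.trans (cong (λ Y → lookup Y l) (∪-identityʳ X)) (≡.sym (∨-identityʳ _))
lookup-∪-⁅⁆ (x ∷ᵛ X) (Fin.suc r) Fin.zero = ≡.refl
lookup-∪-⁅⁆ (x ∷ᵛ X) (Fin.suc r) (Fin.suc l) =
  ≡.trans (lookup-∪-⁅⁆ X r l) (cong (lookup X l ∨_) (≡.sym (suc-==-suc l r)))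

lookup-─-⁅⁆ : ∀ {n} (X : Subset n) (s l : Fin n) → lookup (X ─ ⁅ s ⁆) l ≡ (lookup X l ∧ not (l == s))
lookup-─-⁅⁆ (x ∷ᵛ X) Fin.zero Fin.zero = ≡.sym (∧-zeroʳ x)
lookup-─-⁅⁆ (x ∷ᵛ X) Fin.zero (Fin.suc l) =
  ≡.trans (cong (λ Y → lookup Y l) (p─⊥≡p X)) (≡.sym (∧-identityʳ _))
lookup-─-⁅⁆ (x ∷ᵛ X) (Fin.suc s) Fin.zero = ≡.sym (∧-identityʳ x)
lookup-─-⁅⁆ (x ∷ᵛ X) (Fin.suc s) (Fin.suc l) =
  ≡.trans (lookup-─-⁅⁆ X s l) (cong (λ b → lookup X l ∧ not b) (≡.sym (suc-==-suc l s)))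

∉⇒lookup-false : ∀ {n} (X : Subset n) (r : Fin n) → r ∉ X → lookup X r ≡ false
∉⇒lookup-false X r r∉X with lookup X r in eq
... | true = contradiction (lookup⇒[]= r X eq) r∉X
... | false = ≡.refl

∈⇒≢ : ∀ {n} {X : Subset n} {r l : Fin n} → r ∉ X → lookup X l ≡ true → l ≢ r
∈⇒≢ {X = X} {l = l} r∉X Xl ≡.refl = r∉X (lookup⇒[]= l X Xl)

module _ {N : ℕ} (a b : Fin N) where

  transpose-injective : ∀ {x y} → transpose a b x ≡ transpose a b y → x ≡ y
  transpose-injective {x} {y} eq =
    ≡.trans (≡.sym (transpose-inverse b a)) (≡.trans (cong (transpose b a) eq) (transpose-inverse b a))

  transpose-matchˡ : transpose a b a ≡ b
  transpose-matchˡ rewrite dec-true (a ≟ a) ≡.refl = ≡.refl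

  transpose-matchʳ : transpose a b b ≡ a
  transpose-matchʳ with b ≟ a
  ... | yes b≡a = b≡a
  ... | no _ rewrite dec-true (b ≟ b) ≡.refl = ≡.refl

  transpose-mismatch : ∀ {k} → k ≢ a → k ≢ b → transpose a b k ≡ k
  transpose-mismatch {k} k≢a k≢b rewrite dec-false (k ≟ a) k≢a | dec-false (k ≟ b) k≢b = ≡.refl

  transpose-==ʳ : ∀ x → (transpose a b x == b) ≡ (x == a)
  transpose-==ʳ x = ≡.trans (cong (transpose a b x ==_) (≡.sym transpose-matchˡ))
                            (==-injective (transpose a b) transpose-injective x a)

module _ {n N : ℕ} where

  isInj-entry : (j : Fin n → Fin N) → isInj j ≡ true → ∀ i k → T ((i == k) ∨ not (j i == j k))
  isInj-entry j isInj-j i k = All.lookup (all⁺ _ (allFin n) row-i) (∈-allFin k)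
    where
    row-i = All.lookup (all⁺ _ (allFin n) (Equivalence.from T-≡ isInj-j)) (∈-allFin i)

  isInj⇒injective : (j : Fin n → Fin N) → isInj j ≡ true → ∀ {i k} → j i ≡ j k → i ≡ k
  isInj⇒injective j isInj-j {i} {k} ji≡jk with Equivalence.to T-∨ (isInj-entry j isInj-j i k)
  ... | inj₁ i==k = ==-true⇒≡ (Equivalence.to T-≡ i==k)
  ... | inj₂ j-distinct rewrite ji≡jk | ==-refl (j k) = contradiction j-distinct λ ()

  isInj-resp-== : {j j′ : Fin n → Fin N} → (∀ i k → (j i == j k) ≡ (j′ i == j′ k)) → isInj j ≡ isInj j′
  isInj-resp-== same = cong BL.and (map-cong (λ i → cong BL.and
    (map-cong (λ k → cong (λ b → (i == k) ∨ not b) (same i k)) (allFin n))) (allFin n))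

  isInj-cong : {j j′ : Fin n → Fin N} → (∀ i → j i ≡ j′ i) → isInj j ≡ isInj j′
  isInj-cong j≗j′ = isInj-resp-== λ i k → cong₂ _==_ (j≗j′ i) (j≗j′ k)

  isInj-∘-injective : (τ : Fin N → Fin N) → (∀ {x y} → τ x ≡ τ y → x ≡ y) →
                      (j : Fin n → Fin N) → isInj (τ ∘ j) ≡ isInj j
  isInj-∘-injective τ τ-injective j = isInj-resp-== λ i k → ==-injective τ τ-injective (j i) (j k)

does-≟-true : ∀ b → does (b Bool.≟ true) ≡ b
does-≟-true true = ≡.refl
does-≟-true false = ≡.refl

does-≟-false : ∀ b → does (b Bool.≟ false) ≡ not b
does-≟-false true = ≡.refl
does-≟-false false = ≡.refl

module Sums {c ℓ : Level} (𝒵 : QAlgebra c ℓ) where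

  open QAlgebra 𝒵 hiding (zero)
  open SetoidReasoning setoid
  open AbelianGroupProperties +-abelianGroup using (⁻¹-∙-comm)
  open CommutativeSemigroupProperties *-commutativeSemigroup using (x∙yz≈y∙xz)

  private
    module ι = RingMorphisms.IsRingHomomorphism ι-hom

    ι-homomorphism : CommutativeRing.rawRing +-*-commutativeRing
                     -Raw-AlmostCommutative⟶ fromCommutativeRing cring
    ι-homomorphism = record
      { ⟦_⟧ = ι ; +-homo = ι.+-homo ; *-homo = ι.*-homo ; -‿homo = ι.-‿homo
      ; 0-homo = ι.0#-homo ; 1-homo = ι.1#-homo }

    ι-equal? : (p q : ℚ) → Maybe (ι p ≈ ι q)
    ι-equal? p q with p ℚ.≟ q
    ... | yes p≡q = just (reflexive (cong ι p≡q))
    ... | no _ = nothing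

  open RingSolver _ (fromCommutativeRing cring) ι-homomorphism ι-equal? public
    using (solve; _:=_; _:+_; _:*_; _:-_; :-_; con)

  private variable A B C D E : Set

  ∑ : {A : Set} → List A → (A → Carrier) → Carrier
  ∑ = Σ[_]_ 𝒵

  ∏ : {A : Set} → List A → (A → Carrier) → Carrier
  ∏ = Π[_]_ 𝒵

  -- Indicators, and the neutral factors padding products, are ι 1ℚ and ι 0ℚ rather
  -- than 1# and 0#: the ring solver only recognises constants of the form ι q.
  ⟪_⟫ : Bool → Carrier
  ⟪ b ⟫ = if b then ι 1ℚ else ι 0ℚ

  ι-1 : ι 1ℚ ≈ 1#
  ι-1 = ι.1#-homo

  ι-0 : ι 0ℚ ≈ 0#
  ι-0 = ι.0#-homo

  ι-1-* : ∀ x → ι 1ℚ * x ≈ x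
  ι-1-* x = trans (*-congʳ ι-1) (*-identityˡ x)

  ι-0-* : ∀ x → ι 0ℚ * x ≈ 0#
  ι-0-* x = trans (*-congʳ ι-0) (zeroˡ x)

  ∑-cong : (xs : List A) {f g : A → Carrier} → (∀ x → f x ≈ g x) → ∑ xs f ≈ ∑ xs g
  ∑-cong [] f≈g = refl
  ∑-cong (x ∷ xs) f≈g = +-cong (f≈g x) (∑-cong xs f≈g)

  ∏-cong : (xs : List A) {f g : A → Carrier} → (∀ x → f x ≈ g x) → ∏ xs f ≈ ∏ xs g
  ∏-cong [] f≈g = refl
  ∏-cong (x ∷ xs) f≈g = *-cong (f≈g x) (∏-cong xs f≈g)

  ∑-zero : (xs : List A) {f : A → Carrier} → (∀ x → f x ≈ 0#) → ∑ xs f ≈ 0#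
  ∑-zero [] f≈0 = refl
  ∑-zero (x ∷ xs) f≈0 = trans (+-cong (f≈0 x) (∑-zero xs f≈0)) (+-identityʳ 0#)

  ∑-distrib-+ : (xs : List A) (f g : A → Carrier) → ∑ xs (λ x → f x + g x) ≈ ∑ xs f + ∑ xs g
  ∑-distrib-+ [] f g = sym (+-identityʳ 0#)
  ∑-distrib-+ (x ∷ xs) f g = trans (+-congˡ (∑-distrib-+ xs f g)) (interchange _ _ _ _)
    where
    interchange : ∀ a b c d → (a + c) + (b + d) ≈ (a + b) + (c + d)
    interchange = solve 4 (λ a b c d → (a :+ c) :+ (b :+ d) := (a :+ b) :+ (c :+ d)) refl

  -‿distrib-∑ : (xs : List A) (f : A → Carrier) → - ∑ xs f ≈ ∑ xs (λ x → - f x)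
  -‿distrib-∑ [] f = trans (sym (+-identityˡ (- 0#))) (-‿inverseʳ 0#)
  -‿distrib-∑ (x ∷ xs) f = trans (sym (⁻¹-∙-comm _ _)) (+-congˡ (-‿distrib-∑ xs f))

  ∑-distrib-− : (xs : List A) (f g : A → Carrier) → ∑ xs (λ x → f x - g x) ≈ ∑ xs f - ∑ xs g
  ∑-distrib-− xs f g = trans (∑-distrib-+ xs f (λ x → - g x)) (+-congˡ (sym (-‿distrib-∑ xs g)))

  *-distribˡ-∑ : (c : Carrier) (xs : List A) (f : A → Carrier) → c * ∑ xs f ≈ ∑ xs (λ x → c * f x)
  *-distribˡ-∑ c [] f = zeroʳ c
  *-distribˡ-∑ c (x ∷ xs) f = trans (distribˡ c _ _) (+-congˡ (*-distribˡ-∑ c xs f))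

  *-distribʳ-∑ : (c : Carrier) (xs : List A) (f : A → Carrier) → ∑ xs f * c ≈ ∑ xs (λ x → f x * c)
  *-distribʳ-∑ c xs f = trans (*-comm _ c) (trans (*-distribˡ-∑ c xs f) (∑-cong xs (λ x → *-comm c (f x))))

  *-∑-distrib-+ : ∀ c (xs : List A) (f g : A → Carrier) →
                  c * ∑ xs (λ x → f x + g x) ≈ c * ∑ xs f + c * ∑ xs g
  *-∑-distrib-+ c xs f g = trans (*-congˡ (∑-distrib-+ xs f g)) (distribˡ c _ _)

  *-∑-distrib-− : ∀ c d (xs : List A) (f g : A → Carrier) →
                  c * ∑ xs f - d * ∑ xs g ≈ ∑ xs (λ x → c * f x - d * g x)
  *-∑-distrib-− c d xs f g =
    trans (+-cong (*-distribˡ-∑ c xs f) (-‿cong (*-distribˡ-∑ d xs g))) (sym (∑-distrib-− xs _ _))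

  *-distribˡ-∑₂ : ∀ c (xs : List A) (ys : List B) (f : A → B → Carrier) →
                  c * ∑ xs (λ x → ∑ ys (f x)) ≈ ∑ xs (λ x → ∑ ys (λ y → c * f x y))
  *-distribˡ-∑₂ c xs ys f = trans (*-distribˡ-∑ c xs _) (∑-cong xs λ x → *-distribˡ-∑ c ys (f x))

  ∑-comm : (xs : List A) (ys : List B) (f : A → B → Carrier) →
           ∑ xs (λ x → ∑ ys (f x)) ≈ ∑ ys (λ y → ∑ xs (λ x → f x y))
  ∑-comm [] ys f = sym (∑-zero ys (λ _ → refl))
  ∑-comm (x ∷ xs) ys f = trans (+-congˡ (∑-comm xs ys f)) (sym (∑-distrib-+ ys (f x) _))

  ∑-sink₃ : (l₁ : List A) (l₂ : List B) (l₃ : List C) (f : A → B → C → Carrier) →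
            ∑ l₁ (λ a → ∑ l₂ (λ b → ∑ l₃ (f a b))) ≈ ∑ l₂ (λ b → ∑ l₃ (λ c → ∑ l₁ (λ a → f a b c)))
  ∑-sink₃ l₁ l₂ l₃ f = trans (∑-comm l₁ l₂ _) (∑-cong l₂ λ b → ∑-comm l₁ l₃ _)

  ∑-sink₄ : (l₁ : List A) (l₂ : List B) (l₃ : List C) (l₄ : List D) (f : A → B → C → D → Carrier) →
            ∑ l₁ (λ a → ∑ l₂ (λ b → ∑ l₃ (λ c → ∑ l₄ (f a b c)))) ≈
            ∑ l₂ (λ b → ∑ l₃ (λ c → ∑ l₄ (λ d → ∑ l₁ (λ a → f a b c d))))
  ∑-sink₄ l₁ l₂ l₃ l₄ f = trans (∑-comm l₁ l₂ _) (∑-cong l₂ λ b → ∑-sink₃ l₁ l₃ l₄ _)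

  ∑-sink₅ : (l₁ : List A) (l₂ : List B) (l₃ : List C) (l₄ : List D) (l₅ : List E)
            (f : A → B → C → D → E → Carrier) →
            ∑ l₁ (λ a → ∑ l₂ (λ b → ∑ l₃ (λ c → ∑ l₄ (λ d → ∑ l₅ (f a b c d))))) ≈
            ∑ l₂ (λ b → ∑ l₃ (λ c → ∑ l₄ (λ d → ∑ l₅ (λ e → ∑ l₁ (λ a → f a b c d e)))))
  ∑-sink₅ l₁ l₂ l₃ l₄ l₅ f = trans (∑-comm l₁ l₂ _) (∑-cong l₂ λ b → ∑-sink₄ l₁ l₃ l₄ l₅ _)

  ∑-reverse₅ : (l₁ : List A) (l₂ : List B) (l₃ : List C) (l₄ : List D) (l₅ : List E)
               (f : A → B → C → D → E → Carrier) →
               ∑ l₁ (λ a → ∑ l₂ (λ b → ∑ l₃ (λ c → ∑ l₄ (λ d → ∑ l₅ (f a b c d))))) ≈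
               ∑ l₅ (λ e → ∑ l₄ (λ d → ∑ l₃ (λ c → ∑ l₂ (λ b → ∑ l₁ (λ a → f a b c d e)))))
  ∑-reverse₅ l₁ l₂ l₃ l₄ l₅ f = begin
    ∑ l₁ (λ a → ∑ l₂ (λ b → ∑ l₃ (λ c → ∑ l₄ (λ d → ∑ l₅ (f a b c d)))))
      ≈⟨ ∑-cong l₁ (λ a → ∑-cong l₂ λ b → ∑-cong l₃ λ c → ∑-comm l₄ l₅ _) ⟩
    ∑ l₁ (λ a → ∑ l₂ (λ b → ∑ l₃ (λ c → ∑ l₅ (λ e → ∑ l₄ (λ d → f a b c d e)))))
      ≈⟨ ∑-cong l₁ (λ a → ∑-cong l₂ λ b → ∑-sink₃ l₃ l₅ l₄ _) ⟩
    ∑ l₁ (λ a → ∑ l₂ (λ b → ∑ l₅ (λ e → ∑ l₄ (λ d → ∑ l₃ (λ c → f a b c d e)))))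
      ≈⟨ ∑-cong l₁ (λ a → ∑-sink₄ l₂ l₅ l₄ l₃ _) ⟩
    ∑ l₁ (λ a → ∑ l₅ (λ e → ∑ l₄ (λ d → ∑ l₃ (λ c → ∑ l₂ (λ b → f a b c d e)))))
      ≈⟨ ∑-sink₅ l₁ l₅ l₄ l₃ l₂ _ ⟩
    ∑ l₅ (λ e → ∑ l₄ (λ d → ∑ l₃ (λ c → ∑ l₂ (λ b → ∑ l₁ (λ a → f a b c d e))))) ∎

  ∑-++ : (xs ys : List A) (f : A → Carrier) → ∑ (xs ++ ys) f ≈ ∑ xs f + ∑ ys f
  ∑-++ [] ys f = sym (+-identityˡ _)
  ∑-++ (x ∷ xs) ys f = trans (+-congˡ (∑-++ xs ys f)) (sym (+-assoc _ _ _))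

  ∑-concatMap : (g : A → List B) (xs : List A) (f : B → Carrier) →
                ∑ (concatMap g xs) f ≈ ∑ xs (λ x → ∑ (g x) f)
  ∑-concatMap g [] f = refl
  ∑-concatMap g (x ∷ xs) f = trans (∑-++ (g x) (concatMap g xs) f) (+-congˡ (∑-concatMap g xs f))

  ∑-map : (g : A → B) (xs : List A) (f : B → Carrier) → ∑ (map g xs) f ≡ ∑ xs (f ∘ g)
  ∑-map g [] f = ≡.refl
  ∑-map g (x ∷ xs) f = cong (f (g x) +_) (∑-map g xs f)

  ∑-filter : ∀ {p} {Q : Pred A p} (Q? : Decidable Q) (xs : List A) (f : A → Carrier) →
             ∑ (filter Q? xs) f ≈ ∑ xs (λ x → ⟪ does (Q? x) ⟫ * f x)
  ∑-filter Q? [] f = refl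
  ∑-filter Q? (x ∷ xs) f with does (Q? x)
  ... | true = +-cong (sym (ι-1-* _)) (∑-filter Q? xs f)
  ... | false = trans (∑-filter Q? xs f) (sym (trans (+-congʳ (ι-0-* _)) (+-identityˡ _)))

  ∏-filter : ∀ {p} {Q : Pred A p} (Q? : Decidable Q) (xs : List A) (f : A → Carrier) →
             ∏ (filter Q? xs) f ≈ ∏ xs (λ x → if does (Q? x) then f x else ι 1ℚ)
  ∏-filter Q? [] f = refl
  ∏-filter Q? (x ∷ xs) f with does (Q? x)
  ... | true = *-congˡ (∏-filter Q? xs f)
  ... | false = trans (∏-filter Q? xs f) (sym (ι-1-* _))

  ∑-tabulate : ∀ n (g : Fin n → A) (f : A → Carrier) → ∑ (tabulate g) f ≡ ∑ (allFin n) (f ∘ g)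
  ∑-tabulate ℕ.zero g f = ≡.refl
  ∑-tabulate (ℕ.suc n) g f = cong (f (g Fin.zero) +_)
    (≡.trans (∑-tabulate n (g ∘ Fin.suc) f) (≡.sym (∑-tabulate n Fin.suc (f ∘ g))))

  ∏-tabulate : ∀ n (g : Fin n → A) (f : A → Carrier) → ∏ (tabulate g) f ≡ ∏ (allFin n) (f ∘ g)
  ∏-tabulate ℕ.zero g f = ≡.refl
  ∏-tabulate (ℕ.suc n) g f = cong (f (g Fin.zero) *_)
    (≡.trans (∏-tabulate n (g ∘ Fin.suc) f) (≡.sym (∏-tabulate n Fin.suc (f ∘ g))))

  ∑-allFin-suc : ∀ n (f : Fin (ℕ.suc n) → Carrier) → ∑ (allFin (ℕ.suc n)) f ≡ f Fin.zero + ∑ (allFin n) (f ∘ Fin.suc)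
  ∑-allFin-suc n f = cong (f Fin.zero +_) (∑-tabulate n Fin.suc f)

  ∏-allFin-suc : ∀ n (f : Fin (ℕ.suc n) → Carrier) → ∏ (allFin (ℕ.suc n)) f ≡ f Fin.zero * ∏ (allFin n) (f ∘ Fin.suc)
  ∏-allFin-suc n f = cong (f Fin.zero *_) (∏-tabulate n Fin.suc f)

  private
    module Sum = CommutativeMonoidSum +-commutativeMonoid

    ∑-allFin≡sum : ∀ n (f : Fin n → Carrier) → ∑ (allFin n) f ≡ Sum.sum f
    ∑-allFin≡sum ℕ.zero f = ≡.refl
    ∑-allFin≡sum (ℕ.suc n) f = ≡.trans (∑-allFin-suc n f) (cong (f Fin.zero +_) (∑-allFin≡sum n (f ∘ Fin.suc)))

  ∑-allFin-transpose : ∀ n (a b : Fin n) (f : Fin n → Carrier) → ∑ (allFin n) (f ∘ transpose a b) ≈ ∑ (allFin n) f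
  ∑-allFin-transpose n a b f = begin
    ∑ (allFin n) (f ∘ transpose a b) ≡⟨ ∑-allFin≡sum n _ ⟩
    Sum.sum (f ∘ transpose a b)      ≈⟨ Sum.sum-permute f (Permutation.transpose a b) ⟨
    Sum.sum f                        ≡⟨ ∑-allFin≡sum n f ⟨
    ∑ (allFin n) f                   ∎

  ∑-allFin-select : ∀ n (x : Fin n) (f : Fin n → Carrier) → ∑ (allFin n) (λ u → ⟪ x == u ⟫ * f u) ≈ f x
  ∑-allFin-select (ℕ.suc n) Fin.zero f = begin
    ∑ (allFin (ℕ.suc n)) (λ u → ⟪ Fin.zero == u ⟫ * f u)  ≡⟨ ∑-allFin-suc n _ ⟩
    ι 1ℚ * f Fin.zero + ∑ (allFin n) (λ u → ι 0ℚ * f (Fin.suc u))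
      ≈⟨ +-cong (ι-1-* _) (∑-zero (allFin n) (λ u → ι-0-* _)) ⟩
    f Fin.zero + 0#                                       ≈⟨ +-identityʳ _ ⟩
    f Fin.zero                                            ∎
  ∑-allFin-select (ℕ.suc n) (Fin.suc x) f = begin
    ∑ (allFin (ℕ.suc n)) (λ u → ⟪ Fin.suc x == u ⟫ * f u)  ≡⟨ ∑-allFin-suc n _ ⟩
    ι 0ℚ * f Fin.zero + ∑ (allFin n) (λ u → ⟪ Fin.suc x == Fin.suc u ⟫ * f (Fin.suc u))
      ≈⟨ +-cong (ι-0-* _) (∑-cong (allFin n) (λ u → reflexive (cong (λ b → ⟪ b ⟫ * f (Fin.suc u)) (suc-==-suc x u)))) ⟩
    0# + ∑ (allFin n) (λ u → ⟪ x == u ⟫ * f (Fin.suc u))     ≈⟨ +-identityˡ _ ⟩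
    ∑ (allFin n) (λ u → ⟪ x == u ⟫ * f (Fin.suc u))          ≈⟨ ∑-allFin-select n x (f ∘ Fin.suc) ⟩
    f (Fin.suc x)                                            ∎

  erase : ∀ {n} → Fin n → (Fin n → Carrier) → Fin n → Carrier
  erase s h l = if l == s then ι 1ℚ else h l

  ∏-allFin-extract : ∀ n (s : Fin n) (h : Fin n → Carrier) → ∏ (allFin n) h ≈ h s * ∏ (allFin n) (erase s h)
  ∏-allFin-extract (ℕ.suc n) Fin.zero h = begin
    ∏ (allFin (ℕ.suc n)) h                           ≡⟨ ∏-allFin-suc n h ⟩
    h Fin.zero * ∏ (allFin n) (h ∘ Fin.suc)          ≈⟨ *-congˡ (ι-1-* _) ⟨
    h Fin.zero * (ι 1ℚ * ∏ (allFin n) (h ∘ Fin.suc)) ≡⟨ cong (h Fin.zero *_) (∏-allFin-suc n _) ⟨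
    h Fin.zero * ∏ (allFin (ℕ.suc n)) (λ l → if l == Fin.zero then ι 1ℚ else h l) ∎
  ∏-allFin-extract (ℕ.suc n) (Fin.suc s) h = begin
    ∏ (allFin (ℕ.suc n)) h                                     ≡⟨ ∏-allFin-suc n h ⟩
    h Fin.zero * ∏ (allFin n) (h ∘ Fin.suc)                    ≈⟨ *-congˡ (∏-allFin-extract n s (h ∘ Fin.suc)) ⟩
    h Fin.zero * (h (Fin.suc s) * ∏ (allFin n) (λ l → if l == s then ι 1ℚ else h (Fin.suc l)))
      ≈⟨ x∙yz≈y∙xz _ _ _ ⟩
    h (Fin.suc s) * (h Fin.zero * ∏ (allFin n) (λ l → if l == s then ι 1ℚ else h (Fin.suc l)))
      ≈⟨ *-congˡ (*-congˡ (∏-cong (allFin n) (λ l → reflexive (cong (λ b → if b then ι 1ℚ else h (Fin.suc l))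
                                                                   (≡.sym (suc-==-suc l s)))))) ⟩
    h (Fin.suc s) * (h Fin.zero * ∏ (allFin n) (λ l → if Fin.suc l == Fin.suc s then ι 1ℚ else h (Fin.suc l)))
      ≡⟨ cong (h (Fin.suc s) *_) (∏-allFin-suc n _) ⟨
    h (Fin.suc s) * ∏ (allFin (ℕ.suc n)) (λ l → if l == Fin.suc s then ι 1ℚ else h l) ∎

  ∏-allFin-update : ∀ n s (h h′ : Fin n → Carrier) → (∀ l → l ≢ s → h′ l ≡ h l) →
                    ∏ (allFin n) h′ ≈ ∏ (allFin n) h + (h′ s - h s) * ∏ (allFin n) (erase s h)
  ∏-allFin-update n s h h′ h′≐h = begin
    ∏ (allFin n) h′                   ≈⟨ ∏-allFin-extract n s h′ ⟩
    h′ s * ∏ (allFin n) (erase s h′)  ≈⟨ *-congˡ (∏-cong (allFin n) (reflexive ∘ erase-agree)) ⟩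
    h′ s * rest                       ≈⟨ solve 3 (λ a b e → a :* e := b :* e :+ (a :- b) :* e) refl _ _ _ ⟩
    h s * rest + (h′ s - h s) * rest  ≈⟨ +-congʳ (∏-allFin-extract n s h) ⟨
    ∏ (allFin n) h + (h′ s - h s) * rest ∎
    where
    rest = ∏ (allFin n) (erase s h)
    erase-agree : ∀ l → erase s h′ l ≡ erase s h l
    erase-agree l with l ≟ s
    ... | yes _ = ≡.refl
    ... | no l≢s = h′≐h l l≢s

  -- The maps enumerated by allFuns are pattern-matching λs, equal to the maps they are
  -- compared with only pointwise; with no function extensionality, summands over
  -- allFuns must respect pointwise equality.
  Extensional : ∀ {n N} → ((Fin n → Fin N) → Carrier) → Set _
  Extensional H = ∀ {j j′} → (∀ i → j i ≡ j′ i) → H j ≈ H j′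

  ∑-allFuns-suc : ∀ n N (H : (Fin (ℕ.suc n) → Fin N) → Carrier) → Extensional H →
                  ∑ (allFuns (ℕ.suc n) N) H ≈ ∑ (allFin N) (λ a → ∑ (allFuns n N) (λ f → H (a Vector.∷ f)))
  ∑-allFuns-suc n N H H-ext = trans (∑-concatMap _ (allFin N) H) (∑-cong (allFin N) λ a →
    trans (reflexive (∑-map _ (allFuns n N) H))
          (∑-cong (allFuns n N) λ f → H-ext λ { Fin.zero → ≡.refl ; (Fin.suc i) → ≡.refl }))

  ∑-allFuns-reindex : ∀ n N (τ : Fin N → Fin N) →
                      (∀ (f : Fin N → Carrier) → ∑ (allFin N) (f ∘ τ) ≈ ∑ (allFin N) f) →
                      (H : (Fin n → Fin N) → Carrier) → Extensional H →
                      ∑ (allFuns n N) (λ j → H (τ ∘ j)) ≈ ∑ (allFuns n N) H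
  ∑-allFuns-reindex ℕ.zero N τ τ-invariant H H-ext = +-congʳ (H-ext λ ())
  ∑-allFuns-reindex (ℕ.suc n) N τ τ-invariant H H-ext = begin
    ∑ (allFuns (ℕ.suc n) N) (λ j → H (τ ∘ j))
      ≈⟨ ∑-allFuns-suc n N (λ j → H (τ ∘ j)) (λ j≗j′ → H-ext (cong τ ∘ j≗j′)) ⟩
    ∑ (allFin N) (λ a → ∑ (allFuns n N) (λ f → H (τ ∘ (a Vector.∷ f))))
      ≈⟨ ∑-cong (allFin N) (λ a → ∑-cong (allFuns n N) (λ f → H-ext λ { Fin.zero → ≡.refl ; (Fin.suc i) → ≡.refl })) ⟩
    ∑ (allFin N) (λ a → ∑ (allFuns n N) (λ f → H (τ a Vector.∷ τ ∘ f)))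
      ≈⟨ ∑-cong (allFin N) (λ a → ∑-allFuns-reindex n N τ τ-invariant (λ f → H (τ a Vector.∷ f))
                                      (λ f≗f′ → H-ext λ { Fin.zero → ≡.refl ; (Fin.suc i) → f≗f′ i })) ⟩
    ∑ (allFin N) (λ a → ∑ (allFuns n N) (λ f → H (τ a Vector.∷ f)))
      ≈⟨ τ-invariant (λ a → ∑ (allFuns n N) (λ f → H (a Vector.∷ f))) ⟩
    ∑ (allFin N) (λ a → ∑ (allFuns n N) (λ f → H (a Vector.∷ f)))
      ≈⟨ ∑-allFuns-suc n N H H-ext ⟨
    ∑ (allFuns (ℕ.suc n) N) H ∎

  ∑-injMaps : ∀ n N (h : (Fin n → Fin N) → Carrier) →
              ∑ (injMaps n N) h ≈ ∑ (allFuns n N) (λ j → ⟪ isInj j ⟫ * h j)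
  ∑-injMaps n N h = trans (∑-filter _ (allFuns n N) h) (∑-cong (allFuns n N) λ j →
    reflexive (cong (λ w → ⟪ w ⟫ * h j) (does-≟-true (isInj j))))

  ∑-filter-at : ∀ {n N} (L : List (Fin n → Fin N)) x u (h : (Fin n → Fin N) → Carrier) →
                ∑ (filter (λ j → j x ≟ u) L) h ≈ ∑ L (λ j → ⟪ j x == u ⟫ * h j)
  ∑-filter-at L x u h = trans (∑-filter _ L h) (∑-cong L λ j →
    reflexive (cong (λ w → ⟪ w ⟫ * h j) (≡.sym (isYes≗does (j x ≟ u)))))

  ∑-distinctPairs : ∀ N (f : Fin N × Fin N → Carrier) →
                    ∑ (distinctPairs N) f ≈ ∑ (allFin N) (λ u → ∑ (allFin N) (λ v → ⟪ not (u == v) ⟫ * f (u , v)))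
  ∑-distinctPairs N f = trans (∑-filter _ (concatMap (λ u → map (u ,_) (allFin N)) (allFin N)) f)
    (trans (∑-concatMap _ (allFin N) _) (∑-cong (allFin N) λ u → trans (reflexive (∑-map (u ,_) (allFin N) _))
      (∑-cong (allFin N) λ v → reflexive (cong (λ w → ⟪ w ⟫ * f (u , v)) (does-≟-false (u == v))))))

module Expansion {c ℓ : Level} (𝒵 : QAlgebra c ℓ) {N n : ℕ} (z : Fin N → Fin n → QAlgebra.Carrier 𝒵) where

  open QAlgebra 𝒵 hiding (zero)
  open Sums 𝒵
  open SetoidReasoning setoid

  factor : (Fin n → Fin N) → Subset n → Fin n → Carrier
  factor j X l = if lookup X l then z (j l) l else ι 1ℚ

  p≈∏factor : ∀ j X → p 𝒵 z j X ≈ ∏ (allFin n) (factor j X)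
  p≈∏factor j X = trans (∏-filter _ (allFin n) _) (∏-cong (allFin n) λ l →
    reflexive (cong (λ b → if b then z (j l) l else ι 1ℚ) (does-≟-true (lookup X l))))

  p-cong : ∀ {j j′} X → (∀ i → j i ≡ j′ i) → p 𝒵 z j X ≈ p 𝒵 z j′ X
  p-cong X j≗j′ = ∏-cong (filter (λ l → lookup X l Bool.≟ true) (allFin n)) λ l →
    reflexive (cong (λ w → z w l) (j≗j′ l))

  factor-cong : ∀ j j′ X l → (lookup X l ≡ true → j l ≡ j′ l) → factor j X l ≡ factor j′ X l
  factor-cong j j′ X l agree with lookup X l
  ... | true = cong (λ w → z w l) (agree ≡.refl)
  ... | false = ≡.refl

  ∏-erase-factor-cong : ∀ j s X Y → (∀ l → l ≢ s → lookup X l ≡ lookup Y l) →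
                        ∏ (allFin n) (erase s (factor j X)) ≈ ∏ (allFin n) (erase s (factor j Y))
  ∏-erase-factor-cong j s X Y X≐Y = ∏-cong (allFin n) λ l → reflexive (agree l)
    where
    agree : ∀ l → erase s (factor j X) l ≡ erase s (factor j Y) l
    agree l with l ≟ s
    ... | yes _ = ≡.refl
    ... | no l≢s = cong (λ b → if b then z (j l) l else ι 1ℚ) (X≐Y l l≢s)

  p-∪-⁅⁆ : ∀ j {X} {r} → r ∉ X → p 𝒵 z j (X ∪ ⁅ r ⁆) ≈ p 𝒵 z j X * z (j r) r
  p-∪-⁅⁆ j {X} {r} r∉X = begin
    p 𝒵 z j (X ∪ ⁅ r ⁆)                             ≈⟨ trans (p≈∏factor j (X ∪ ⁅ r ⁆)) (∏-allFin-extract n r _) ⟩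
    factor j (X ∪ ⁅ r ⁆) r * ∏ (allFin n) (erase r (factor j (X ∪ ⁅ r ⁆)))
      ≈⟨ *-cong (reflexive (cong (λ b → if b then z (j r) r else ι 1ℚ) r∈X∪⁅r⁆))
                (∏-erase-factor-cong j r (X ∪ ⁅ r ⁆) X λ l l≢r → ≡.trans (lookup-∪-⁅⁆ X r l)
                    (≡.trans (cong (lookup X l ∨_) (≢⇒==-false l≢r)) (∨-identityʳ _))) ⟩
    z (j r) r * rest                                ≈⟨ solve 2 (λ x y → x :* y := (con 1ℚ :* y) :* x) refl _ _ ⟩
    (ι 1ℚ * rest) * z (j r) r                       ≡⟨ cong (λ b → (if b then z (j r) r else ι 1ℚ) * rest * z (j r) r) Xr ⟨
    (factor j X r * rest) * z (j r) r               ≈⟨ *-congʳ (trans (p≈∏factor j X) (∏-allFin-extract n r _)) ⟨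
    p 𝒵 z j X * z (j r) r                           ∎
    where
    rest = ∏ (allFin n) (erase r (factor j X))
    Xr = ∉⇒lookup-false X r r∉X
    r∈X∪⁅r⁆ : lookup (X ∪ ⁅ r ⁆) r ≡ true
    r∈X∪⁅r⁆ = ≡.trans (lookup-∪-⁅⁆ X r r) (≡.trans (cong (lookup X r ∨_) (==-refl r)) (∨-zeroʳ _))

  transposeDefect : Subset n → Fin N → (Fin n → Fin N) → Fin N → Carrier
  transposeDefect X a j b =
    ∑ (allFin n) (λ s → ⟪ lookup X s ⟫ * ⟪ j s == b ⟫ * p 𝒵 z j (X ─ ⁅ s ⁆) * y 𝒵 z a b s)

  image-≢-at : ∀ {X r a} (j : Fin n → Fin N) → r ∉ X → isInj j ≡ true → j r ≡ a → ∀ {l} → lookup X l ≡ true → j l ≢ a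
  image-≢-at j r∉X isInj-j jr≡a Xl jl≡a = ∈⇒≢ r∉X Xl (isInj⇒injective j isInj-j (≡.trans jl≡a (≡.sym jr≡a)))

  p-transpose-miss : ∀ {X r a b} j → r ∉ X → isInj j ≡ true → j r ≡ a → (∀ s → j s ≢ b) →
                     p 𝒵 z (transpose a b ∘ j) X ≈ p 𝒵 z j X + transposeDefect X a j b
  p-transpose-miss {X} {r} {a} {b} j r∉X isInj-j jr≡a b∉im = begin
    p 𝒵 z (transpose a b ∘ j) X  ≈⟨ p≈∏factor _ X ⟩
    ∏ (allFin n) (factor (transpose a b ∘ j) X)
      ≈⟨ ∏-cong (allFin n) (λ l → reflexive (factor-cong (transpose a b ∘ j) j X l λ Xl →
            transpose-mismatch a b (image-≢-at j r∉X isInj-j jr≡a Xl) (b∉im l))) ⟩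
    ∏ (allFin n) (factor j X)    ≈⟨ p≈∏factor j X ⟨
    p 𝒵 z j X                    ≈⟨ +-identityʳ _ ⟨
    p 𝒵 z j X + 0#               ≈⟨ +-congˡ (∑-zero (allFin n) vanish) ⟨
    p 𝒵 z j X + transposeDefect X a j b ∎
    where
    vanish : ∀ s → ⟪ lookup X s ⟫ * ⟪ j s == b ⟫ * p 𝒵 z j (X ─ ⁅ s ⁆) * y 𝒵 z a b s ≈ 0#
    vanish s rewrite ≢⇒==-false (b∉im s) =
      trans (solve 3 (λ x q w → x :* con 0ℚ :* q :* w := con 0ℚ) refl _ _ _) ι-0

  p-─-⁅⁆ : ∀ j X s → p 𝒵 z j (X ─ ⁅ s ⁆) ≈ ι 1ℚ * ∏ (allFin n) (erase s (factor j X))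
  p-─-⁅⁆ j X s = begin
    p 𝒵 z j (X ─ ⁅ s ⁆)  ≈⟨ trans (p≈∏factor j (X ─ ⁅ s ⁆)) (∏-allFin-extract n s _) ⟩
    factor j (X ─ ⁅ s ⁆) s * ∏ (allFin n) (erase s (factor j (X ─ ⁅ s ⁆)))
      ≈⟨ *-cong (reflexive (cong (λ b → if b then z (j s) s else ι 1ℚ) s∉X─s))
                (∏-erase-factor-cong j s (X ─ ⁅ s ⁆) X λ l l≢s → ≡.trans (lookup-─-⁅⁆ X s l)
                    (≡.trans (cong (λ w → lookup X l ∧ not w) (≢⇒==-false l≢s)) (∧-identityʳ _))) ⟩
    ι 1ℚ * ∏ (allFin n) (erase s (factor j X)) ∎
    where
    s∉X─s : lookup (X ─ ⁅ s ⁆) s ≡ false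
    s∉X─s = ≡.trans (lookup-─-⁅⁆ X s s) (≡.trans (cong (λ w → lookup X s ∧ not w) (==-refl s)) (∧-zeroʳ _))

  p-transpose-hit : ∀ {X r a b s₀} j → r ∉ X → isInj j ≡ true → j r ≡ a → j s₀ ≡ b →
                    p 𝒵 z (transpose a b ∘ j) X ≈ p 𝒵 z j X + transposeDefect X a j b
  p-transpose-hit {X} {r} {a} {b} {s₀} j r∉X isInj-j jr≡a js₀≡b = begin
    p 𝒵 z (transpose a b ∘ j) X  ≈⟨ p≈∏factor _ X ⟩
    ∏ (allFin n) (factor (transpose a b ∘ j) X)
      ≈⟨ ∏-allFin-update n s₀ (factor j X) (factor (transpose a b ∘ j) X) (λ l l≢s₀ →
           factor-cong (transpose a b ∘ j) j X l λ Xl → transpose-mismatch a b (image-≢-at j r∉X isInj-j jr≡a Xl)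
             (l≢s₀ ∘ injective ∘ flip ≡.trans (≡.sym js₀≡b))) ⟩
    ∏ (allFin n) (factor j X) + (factor (transpose a b ∘ j) X s₀ - factor j X s₀) * rest
      ≈⟨ +-cong (sym (p≈∏factor j X)) jump ⟩
    p 𝒵 z j X + ⟪ lookup X s₀ ⟫ * p 𝒵 z j (X ─ ⁅ s₀ ⁆) * y 𝒵 z a b s₀
      ≈⟨ +-congˡ defect-at-s₀ ⟨
    p 𝒵 z j X + transposeDefect X a j b ∎
    where
    injective = isInj⇒injective j isInj-j
    rest = ∏ (allFin n) (erase s₀ (factor j X))

    jump : (factor (transpose a b ∘ j) X s₀ - factor j X s₀) * rest
           ≈ ⟪ lookup X s₀ ⟫ * p 𝒵 z j (X ─ ⁅ s₀ ⁆) * y 𝒵 z a b s₀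
    jump rewrite js₀≡b | transpose-matchʳ a b =
      trans (jump′ (lookup X s₀)) (*-congʳ (*-congˡ (sym (p-─-⁅⁆ j X s₀))))
      where
      jump′ : ∀ x → ((if x then z a s₀ else ι 1ℚ) - (if x then z b s₀ else ι 1ℚ)) * rest
                    ≈ ⟪ x ⟫ * (ι 1ℚ * rest) * (z a s₀ - z b s₀)
      jump′ true = solve 3 (λ za zb e → (za :- zb) :* e := con 1ℚ :* (con 1ℚ :* e) :* (za :- zb)) refl _ _ _
      jump′ false = solve 3 (λ za zb e → (con 1ℚ :- con 1ℚ) :* e := con 0ℚ :* (con 1ℚ :* e) :* (za :- zb)) refl _ _ _

    defect-at-s₀ : transposeDefect X a j b ≈ ⟪ lookup X s₀ ⟫ * p 𝒵 z j (X ─ ⁅ s₀ ⁆) * y 𝒵 z a b s₀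
    defect-at-s₀ = begin
      transposeDefect X a j b
        ≈⟨ ∑-cong (allFin n) (λ s → trans (reflexive (cong (λ w → ⟪ lookup X s ⟫ * ⟪ w ⟫ * _ * _) (js==b s)))
                                          (solve 4 (λ x d q w → x :* d :* q :* w := d :* (x :* q :* w)) refl _ _ _ _)) ⟩
      ∑ (allFin n) (λ s → ⟪ s₀ == s ⟫ * (⟪ lookup X s ⟫ * p 𝒵 z j (X ─ ⁅ s ⁆) * y 𝒵 z a b s))
        ≈⟨ ∑-allFin-select n s₀ _ ⟩
      ⟪ lookup X s₀ ⟫ * p 𝒵 z j (X ─ ⁅ s₀ ⁆) * y 𝒵 z a b s₀ ∎
      where
      js==b : ∀ s → (j s == b) ≡ (s₀ == s)
      js==b s = ≡.trans (cong (j s ==_) (≡.sym js₀≡b)) (≡.trans (==-injective j injective s s₀) (==-sym s s₀))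

  p-transpose : ∀ {X r a b} j → r ∉ X → isInj j ≡ true → j r ≡ a →
                p 𝒵 z (transpose a b ∘ j) X ≈ p 𝒵 z j X + transposeDefect X a j b
  p-transpose {b = b} j r∉X isInj-j jr≡a with any? (λ s → j s ≟ b)
  ... | yes (s₀ , js₀≡b) = p-transpose-hit j r∉X isInj-j jr≡a js₀≡b
  ... | no b∉im = p-transpose-miss j r∉X isInj-j jr≡a (λ s js≡b → b∉im (s , js≡b))

  χ : (Fin n → Fin N) → Carrier
  χ j = ⟪ isInj j ⟫

  pbar≈∑χp : ∀ X → pbar 𝒵 z X ≈ ∑ (allFuns n N) (λ j → χ j * p 𝒵 z j X)
  pbar≈∑χp X = ∑-injMaps n N (λ j → p 𝒵 z j X)

  module AtPosition (r : Fin n) where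

    ySum : Subset n → Fin N → Carrier
    ySum X a = ∑ (allFuns n N) (λ j → χ j * p 𝒵 z j X * y 𝒵 z a (j r) r)

    slice : Subset n → Fin N → Fin N → (Fin n → Fin N) → Carrier
    slice X a b j = ⟪ j r == b ⟫ * (χ j * p 𝒵 z j X * y 𝒵 z a b r)

    slice-ext : ∀ X a b → Extensional (slice X a b)
    slice-ext X a b j≗j′ = *-cong (reflexive (cong (λ w → ⟪ w == b ⟫) (j≗j′ r)))
                                  (*-congʳ (*-cong (reflexive (cong ⟪_⟫ (isInj-cong j≗j′))) (p-cong X j≗j′)))

    slice-transpose : ∀ {X} a b j → r ∉ X → slice X a b (transpose a b ∘ j) ≈
      χ j * ⟪ j r == a ⟫ * (⟪ not (b == a) ⟫ * y 𝒵 z a b r * (p 𝒵 z j X + transposeDefect X a j b))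
    slice-transpose a b j r∉X
      rewrite transpose-==ʳ a b (j r) | isInj-∘-injective (transpose a b) (transpose-injective a b) j
      with isInj j in isInj-j | j r ≟ a | b ≟ a
    ... | false | _ | _ = solve 4 (λ x q w g → x :* (con 0ℚ :* q :* w) := con 0ℚ :* x :* g) refl _ _ _ _
    ... | true | no _ | _ = solve 3 (λ q w g → con 0ℚ :* (con 1ℚ :* q :* w) := con 1ℚ :* con 0ℚ :* g) refl _ _ _
    ... | true | yes _ | yes ≡.refl =
      solve 3 (λ q x g → con 1ℚ :* (con 1ℚ :* q :* (x :- x)) := con 1ℚ :* con 1ℚ :* (con 0ℚ :* (x :- x) :* g))
            refl _ _ _
    ... | true | yes jr≡a | no _ = trans (*-congˡ (*-congʳ (*-congˡ (p-transpose j r∉X isInj-j jr≡a))))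
      (solve 2 (λ q w → con 1ℚ :* (con 1ℚ :* q :* w) := con 1ℚ :* con 1ℚ :* (con 1ℚ :* w :* q)) refl _ _)

    ySum-transpose : ∀ {X} a → r ∉ X → ySum X a ≈
      ∑ (allFuns n N) (λ j → χ j * ⟪ j r == a ⟫ *
        ∑ (allFin N) (λ b → ⟪ not (b == a) ⟫ * y 𝒵 z a b r * (p 𝒵 z j X + transposeDefect X a j b)))
    ySum-transpose {X} a r∉X = begin
      ySum X a
        ≈⟨ ∑-cong (allFuns n N) (λ j → ∑-allFin-select N (j r) (λ b → χ j * p 𝒵 z j X * y 𝒵 z a b r)) ⟨
      ∑ (allFuns n N) (λ j → ∑ (allFin N) (λ b → slice X a b j))
        ≈⟨ ∑-comm (allFuns n N) (allFin N) _ ⟩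
      ∑ (allFin N) (λ b → ∑ (allFuns n N) (slice X a b))
        ≈⟨ ∑-cong (allFin N) (λ b → ∑-allFuns-reindex n N (transpose a b) (∑-allFin-transpose N a b)
                                      (slice X a b) (slice-ext X a b)) ⟨
      ∑ (allFin N) (λ b → ∑ (allFuns n N) (λ j → slice X a b (transpose a b ∘ j)))
        ≈⟨ ∑-cong (allFin N) (λ b → ∑-cong (allFuns n N) λ j → slice-transpose a b j r∉X) ⟩
      ∑ (allFin N) (λ b → ∑ (allFuns n N) (λ j → χ j * ⟪ j r == a ⟫ * G j b))
        ≈⟨ ∑-comm (allFin N) (allFuns n N) _ ⟩
      ∑ (allFuns n N) (λ j → ∑ (allFin N) (λ b → χ j * ⟪ j r == a ⟫ * G j b))
        ≈⟨ ∑-cong (allFuns n N) (λ j → *-distribˡ-∑ _ (allFin N) (G j)) ⟨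
      ∑ (allFuns n N) (λ j → χ j * ⟪ j r == a ⟫ * ∑ (allFin N) (G j)) ∎
      where
      G : (Fin n → Fin N) → Fin N → Carrier
      G j b = ⟪ not (b == a) ⟫ * y 𝒵 z a b r * (p 𝒵 z j X + transposeDefect X a j b)

    cross : Subset n → Subset n → Carrier
    cross X Y = ∑ (allFuns n N) (λ k → χ k * p 𝒵 z k Y * ySum X (k r))

    private
      pairedWith : Subset n → (Fin n → Fin N) → (Fin N → (Fin n → Fin N) → Fin N → Carrier) → Carrier
      pairedWith Y k w = χ k * p 𝒵 z k Y * ∑ (allFuns n N) (λ j → χ j * ⟪ j r == k r ⟫ *
                           ∑ (allFin N) (λ b → ⟪ not (b == k r) ⟫ * y 𝒵 z (k r) b r * w (k r) j b))

    symmetricPart : Subset n → Subset n → Carrier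
    symmetricPart X Y = ∑ (allFuns n N) (λ k → pairedWith Y k (λ _ j _ → p 𝒵 z j X))

    defectPart : Subset n → Subset n → Carrier
    defectPart X Y = ∑ (allFuns n N) (λ k → pairedWith Y k (transposeDefect X))

    cross-split : ∀ {X} Y → r ∉ X → cross X Y ≈ symmetricPart X Y + defectPart X Y
    cross-split {X} Y r∉X = begin
      cross X Y
        ≈⟨ ∑-cong (allFuns n N) (λ k → *-congˡ (trans (ySum-transpose (k r) r∉X)
             (∑-cong (allFuns n N) λ j → *-congˡ (∑-cong (allFin N) λ b → distribˡ _ _ _)))) ⟩
      ∑ (allFuns n N) (λ k → χ k * p 𝒵 z k Y * ∑ (allFuns n N) (λ j → χ j * ⟪ j r == k r ⟫ *
        ∑ (allFin N) (λ b → e k b * p 𝒵 z j X + e k b * transposeDefect X (k r) j b)))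
        ≈⟨ ∑-cong (allFuns n N) (λ k → *-congˡ (∑-cong (allFuns n N) λ j → *-∑-distrib-+ _ (allFin N) _ _)) ⟩
      ∑ (allFuns n N) (λ k → χ k * p 𝒵 z k Y * ∑ (allFuns n N) (λ j →
        χ j * ⟪ j r == k r ⟫ * ∑ (allFin N) (λ b → e k b * p 𝒵 z j X) +
        χ j * ⟪ j r == k r ⟫ * ∑ (allFin N) (λ b → e k b * transposeDefect X (k r) j b)))
        ≈⟨ ∑-cong (allFuns n N) (λ k → *-∑-distrib-+ _ (allFuns n N) _ _) ⟩
      ∑ (allFuns n N) (λ k → pairedWith Y k (λ _ j _ → p 𝒵 z j X) + pairedWith Y k (transposeDefect X))
        ≈⟨ ∑-distrib-+ (allFuns n N) _ _ ⟩
      symmetricPart X Y + defectPart X Y ∎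
      where
      e : (Fin n → Fin N) → Fin N → Carrier
      e k b = ⟪ not (b == k r) ⟫ * y 𝒵 z (k r) b r

    cross-antisym : ∀ X Y → cross X Y ≈ - cross Y X
    cross-antisym X Y = begin
      cross X Y
        ≈⟨ ∑-cong (allFuns n N) (λ k → *-distribˡ-∑ _ (allFuns n N) _) ⟩
      ∑ (allFuns n N) (λ k → ∑ (allFuns n N) (λ j → χ k * p 𝒵 z k Y * (χ j * p 𝒵 z j X * y 𝒵 z (k r) (j r) r)))
        ≈⟨ ∑-cong (allFuns n N) (λ k → ∑-cong (allFuns n N) λ j → swap-sign _ _ _ _ (z (k r) r) (z (j r) r)) ⟩
      ∑ (allFuns n N) (λ k → ∑ (allFuns n N) (λ j → - (χ j * p 𝒵 z j X * (χ k * p 𝒵 z k Y * y 𝒵 z (j r) (k r) r))))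
        ≈⟨ trans (-‿distrib-∑ (allFuns n N) _) (∑-cong (allFuns n N) λ k → -‿distrib-∑ (allFuns n N) _) ⟨
      - ∑ (allFuns n N) (λ k → ∑ (allFuns n N) (λ j → χ j * p 𝒵 z j X * (χ k * p 𝒵 z k Y * y 𝒵 z (j r) (k r) r)))
        ≈⟨ -‿cong (∑-comm (allFuns n N) (allFuns n N) _) ⟩
      - ∑ (allFuns n N) (λ j → ∑ (allFuns n N) (λ k → χ j * p 𝒵 z j X * (χ k * p 𝒵 z k Y * y 𝒵 z (j r) (k r) r)))
        ≈⟨ -‿cong (∑-cong (allFuns n N) λ j → *-distribˡ-∑ _ (allFuns n N) _) ⟨
      - cross Y X ∎
      where
      swap-sign : ∀ a b c d x w → a * b * (c * d * (x - w)) ≈ - (c * d * (a * b * (w - x)))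
      swap-sign = solve 6 (λ a b c d x w → a :* b :* (c :* d :* (x :- w)) := :- (c :* d :* (a :* b :* (w :- x)))) refl

    lhs≈cross : ∀ {R S} → r ∉ R → r ∉ S →
                (pbar 𝒵 z (R ∪ ⁅ r ⁆) * pbar 𝒵 z S) - (pbar 𝒵 z R * pbar 𝒵 z (S ∪ ⁅ r ⁆)) ≈ cross S R
    lhs≈cross {R} {S} r∉R r∉S = begin
      (pbar 𝒵 z (R ∪ ⁅ r ⁆) * pbar 𝒵 z S) - (pbar 𝒵 z R * pbar 𝒵 z (S ∪ ⁅ r ⁆))
        ≈⟨ +-cong (*-cong (trans (pbar≈∑χp (R ∪ ⁅ r ⁆)) (∑-cong (allFuns n N) λ k → *-congˡ (p-∪-⁅⁆ k r∉R))) (pbar≈∑χp S))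
                  (-‿cong (*-cong (pbar≈∑χp R) (trans (pbar≈∑χp (S ∪ ⁅ r ⁆)) (∑-cong (allFuns n N) λ j → *-congˡ (p-∪-⁅⁆ j r∉S))))) ⟩
      ∑ (allFuns n N) (λ k → χ k * (p 𝒵 z k R * z (k r) r)) * ∑ (allFuns n N) (λ j → χ j * p 𝒵 z j S)
        - ∑ (allFuns n N) (λ k → χ k * p 𝒵 z k R) * ∑ (allFuns n N) (λ j → χ j * (p 𝒵 z j S * z (j r) r))
        ≈⟨ +-cong (*-distribʳ-∑ _ (allFuns n N) _) (-‿cong (*-distribʳ-∑ _ (allFuns n N) _)) ⟩
      ∑ (allFuns n N) (λ k → χ k * (p 𝒵 z k R * z (k r) r) * ∑ (allFuns n N) (λ j → χ j * p 𝒵 z j S))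
        - ∑ (allFuns n N) (λ k → χ k * p 𝒵 z k R * ∑ (allFuns n N) (λ j → χ j * (p 𝒵 z j S * z (j r) r)))
        ≈⟨ ∑-distrib-− (allFuns n N) _ _ ⟨
      ∑ (allFuns n N) (λ k → χ k * (p 𝒵 z k R * z (k r) r) * ∑ (allFuns n N) (λ j → χ j * p 𝒵 z j S)
        - χ k * p 𝒵 z k R * ∑ (allFuns n N) (λ j → χ j * (p 𝒵 z j S * z (j r) r)))
        ≈⟨ ∑-cong (allFuns n N) (λ k → trans (*-∑-distrib-− _ _ (allFuns n N) _ _)
             (trans (∑-cong (allFuns n N) λ j → factor-out _ _ _ _ _ _) (sym (*-distribˡ-∑ _ (allFuns n N) _)))) ⟩
      cross S R ∎
      where
      factor-out : ∀ ck pk zk cj pj zj → (ck * (pk * zk)) * (cj * pj) - (ck * pk) * (cj * (pj * zj)) ≈ (ck * pk) * (cj * pj * (zk - zj))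
      factor-out = solve 6 (λ ck pk zk cj pj zj → (ck :* (pk :* zk)) :* (cj :* pj) :- (ck :* pk) :* (cj :* (pj :* zj))
                                                 := (ck :* pk) :* (cj :* pj :* (zk :- zj))) refl

    symmetricPart-comm : ∀ X Y → symmetricPart X Y ≈ symmetricPart Y X
    symmetricPart-comm X Y = begin
      symmetricPart X Y                                          ≈⟨ product-form X Y ⟩
      ∑ (allFuns n N) (λ k → ∑ (allFuns n N) (λ j → term X Y k j)) ≈⟨ ∑-cong (allFuns n N) (λ k → ∑-cong (allFuns n N) (term-swap k)) ⟩
      ∑ (allFuns n N) (λ k → ∑ (allFuns n N) (λ j → term Y X j k)) ≈⟨ ∑-comm (allFuns n N) (allFuns n N) _ ⟩
      ∑ (allFuns n N) (λ j → ∑ (allFuns n N) (λ k → term Y X j k)) ≈⟨ product-form Y X ⟨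
      symmetricPart Y X                                          ∎
      where
      Q : Fin N → Carrier
      Q a = ∑ (allFin N) (λ b → ⟪ not (b == a) ⟫ * y 𝒵 z a b r)

      term : Subset n → Subset n → (Fin n → Fin N) → (Fin n → Fin N) → Carrier
      term X Y k j = χ k * p 𝒵 z k Y * (χ j * ⟪ j r == k r ⟫ * (Q (k r) * p 𝒵 z j X))

      product-form : ∀ X Y → symmetricPart X Y ≈ ∑ (allFuns n N) (λ k → ∑ (allFuns n N) (term X Y k))
      product-form X Y = ∑-cong (allFuns n N) λ k →
        trans (*-congˡ (∑-cong (allFuns n N) λ j → *-congˡ (sym (*-distribʳ-∑ _ (allFin N) _))))
              (*-distribˡ-∑ _ (allFuns n N) _)

      term-swap : ∀ k j → term X Y k j ≈ term Y X j k
      term-swap k j with j r ≟ k r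
      ... | yes jr≡kr rewrite jr≡kr | ==-refl (k r) =
        solve 6 (λ a b c w q e → a :* b :* (c :* w :* (q :* e)) := c :* e :* (a :* w :* (q :* b))) refl _ _ _ _ _ _
      ... | no jr≢kr rewrite ≢⇒==-false (jr≢kr ∘ ≡.sym) = trans (vanish _ _ _ _ _) (sym (vanish _ _ _ _ _))
        where
        vanish : ∀ a b c q e → a * b * (c * ι 0ℚ * (q * e)) ≈ ι 0ℚ
        vanish = solve 5 (λ a b c q e → a :* b :* (c :* con 0ℚ :* (q :* e)) := con 0ℚ) refl

    lhs≈½defects : ∀ {R S} → r ∉ R → r ∉ S →
                   (pbar 𝒵 z (R ∪ ⁅ r ⁆) * pbar 𝒵 z S) - (pbar 𝒵 z R * pbar 𝒵 z (S ∪ ⁅ r ⁆))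
                   ≈ ι ½ * (defectPart S R - defectPart R S)
    lhs≈½defects {R} {S} r∉R r∉S = begin
      L                  ≈⟨ solve 1 (λ x → x := con ½ :* (x :+ x)) refl L ⟩
      ι ½ * (L + L)      ≈⟨ *-congˡ (+-cong (lhs≈cross r∉R r∉S) (trans (lhs≈cross r∉R r∉S) (cross-antisym S R))) ⟩
      ι ½ * (cross S R + - cross R S)
        ≈⟨ *-congˡ (+-cong (cross-split R r∉S) (-‿cong (cross-split S r∉R))) ⟩
      ι ½ * ((symmetricPart S R + defectPart S R) - (symmetricPart R S + defectPart R S))
        ≈⟨ *-congˡ (+-congʳ (+-congʳ (symmetricPart-comm S R))) ⟩
      ι ½ * ((symmetricPart R S + defectPart S R) - (symmetricPart R S + defectPart R S))
        ≈⟨ *-congˡ (solve 3 (λ a b c → (a :+ b) :- (a :+ c) := b :- c) refl _ _ _) ⟩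
      ι ½ * (defectPart S R - defectPart R S) ∎
      where
      L = (pbar 𝒵 z (R ∪ ⁅ r ⁆) * pbar 𝒵 z S) - (pbar 𝒵 z R * pbar 𝒵 z (S ∪ ⁅ r ⁆))

    ∑ₛᵤᵥⱼₖ : (Fin n → Fin N → Fin N → (Fin n → Fin N) → (Fin n → Fin N) → Carrier) → Carrier
    ∑ₛᵤᵥⱼₖ t = ∑ (allFin n) λ s → ∑ (allFin N) λ u → ∑ (allFin N) λ v →
                 ∑ (allFuns n N) λ j → ∑ (allFuns n N) λ k → t s u v j k

    ∑ₛᵤᵥⱼₖ-cong : ∀ {t t′} → (∀ s u v j k → t s u v j k ≈ t′ s u v j k) → ∑ₛᵤᵥⱼₖ t ≈ ∑ₛᵤᵥⱼₖ t′
    ∑ₛᵤᵥⱼₖ-cong t≈t′ = ∑-cong (allFin n) λ s → ∑-cong (allFin N) λ u → ∑-cong (allFin N) λ v →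
                         ∑-cong (allFuns n N) λ j → ∑-cong (allFuns n N) λ k → t≈t′ s u v j k

    ∑ₛᵤᵥⱼₖ-distrib-− : ∀ t t′ → ∑ₛᵤᵥⱼₖ (λ s u v j k → t s u v j k - t′ s u v j k) ≈ ∑ₛᵤᵥⱼₖ t - ∑ₛᵤᵥⱼₖ t′
    ∑ₛᵤᵥⱼₖ-distrib-− t t′ =
      trans (∑-cong (allFin n) λ s → trans (∑-cong (allFin N) λ u → trans (∑-cong (allFin N) λ v →
              trans (∑-cong (allFuns n N) λ j → ∑-distrib-− (allFuns n N) _ _) (∑-distrib-− (allFuns n N) _ _))
            (∑-distrib-− (allFin N) _ _)) (∑-distrib-− (allFin N) _ _))
        (∑-distrib-− (allFin n) _ _)

    weight : Fin n → Fin N → Fin N → (Fin n → Fin N) → (Fin n → Fin N) → Carrier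
    weight s u v j k = ⟪ not (u == v) ⟫ * (y 𝒵 z u v r * y 𝒵 z u v s) *
                       (χ j * ⟪ j s == v ⟫ * ⟪ j r == u ⟫) * (χ k * ⟪ k r == u ⟫)

    defectTerm : Subset n → Subset n → Fin n → Fin N → Fin N → (Fin n → Fin N) → (Fin n → Fin N) → Carrier
    defectTerm X Y s u v j k = weight s u v j k * (⟪ lookup X s ⟫ * p 𝒵 z j (X ─ ⁅ s ⁆) * p 𝒵 z k Y)

    defectPart-expand : ∀ X Y → defectPart X Y ≈ ∑ₛᵤᵥⱼₖ (defectTerm X Y)
    defectPart-expand X Y = begin
      defectPart X Y
        ≈⟨ ∑-cong (allFuns n N) (λ k → trans (*-congˡ (∑-cong (allFuns n N) λ j →
             trans (*-congˡ (∑-cong (allFin N) λ b → *-distribˡ-∑ _ (allFin n) _)) (*-distribˡ-∑₂ _ (allFin N) (allFin n) _)))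
             (trans (*-distribˡ-∑ _ (allFuns n N) _) (∑-cong (allFuns n N) λ j → *-distribˡ-∑₂ _ (allFin N) (allFin n) _))) ⟩
      ∑ (allFuns n N) (λ k → ∑ (allFuns n N) λ j → ∑ (allFin N) λ b → ∑ (allFin n) λ s → g k j b s (k r))
        ≈⟨ ∑-cong (allFuns n N) (λ k → ∑-cong (allFuns n N) λ j → ∑-cong (allFin N) λ b →
             trans (sym (∑-allFin-select N (k r) _)) (∑-cong (allFin N) λ u → *-distribˡ-∑ _ (allFin n) _)) ⟩
      ∑ (allFuns n N) (λ k → ∑ (allFuns n N) λ j → ∑ (allFin N) λ v → ∑ (allFin N) λ u → ∑ (allFin n) λ s →
        ⟪ k r == u ⟫ * g k j v s u)
        ≈⟨ ∑-reverse₅ (allFuns n N) (allFuns n N) (allFin N) (allFin N) (allFin n) _ ⟩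
      ∑ₛᵤᵥⱼₖ (λ s u v j k → ⟪ k r == u ⟫ * g k j v s u)
        ≈⟨ ∑ₛᵤᵥⱼₖ-cong rearrange ⟩
      ∑ₛᵤᵥⱼₖ (defectTerm X Y) ∎
      where
      g : (Fin n → Fin N) → (Fin n → Fin N) → Fin N → Fin n → Fin N → Carrier
      g k j v s u = χ k * p 𝒵 z k Y * (χ j * ⟪ j r == u ⟫ * (⟪ not (v == u) ⟫ * y 𝒵 z u v r *
                      (⟪ lookup X s ⟫ * ⟪ j s == v ⟫ * p 𝒵 z j (X ─ ⁅ s ⁆) * y 𝒵 z u v s)))

      rearrange : ∀ s u v j k → ⟪ k r == u ⟫ * g k j v s u ≈ defectTerm X Y s u v j k
      rearrange s u v j k rewrite ==-sym v u = solve 11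
        (λ kru ck pk cj jru nuv yr xs jsv pj ys →
           kru :* (ck :* pk :* (cj :* jru :* (nuv :* yr :* (xs :* jsv :* pj :* ys)))) :=
           nuv :* (yr :* ys) :* (cj :* jsv :* jru) :* (ck :* kru) :* (xs :* pj :* pk))
        refl _ _ _ _ _ _ _ _ _ _ _

    ∑-restricted-pairs : ∀ s u v (t : (Fin n → Fin N) → (Fin n → Fin N) → Carrier) →
      ∑ (filter (λ j → j r ≟ u) (filter (λ j → j s ≟ v) (injMaps n N))) (λ j → ∑ (filter (λ k → k r ≟ u) (injMaps n N)) (t j))
      ≈ ∑ (allFuns n N) (λ j → ∑ (allFuns n N) λ k → χ j * (⟪ j s == v ⟫ * (⟪ j r == u ⟫ * (χ k * (⟪ k r == u ⟫ * t j k)))))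
    ∑-restricted-pairs s u v t =
      trans (∑-filter-at (filter (λ j → j s ≟ v) (injMaps n N)) r u _) (trans (∑-filter-at (injMaps n N) s v _)
        (trans (∑-injMaps n N _) (∑-cong (allFuns n N) λ j →
          trans (*-congˡ (*-congˡ (*-congˡ (trans (∑-filter-at (injMaps n N) r u _) (∑-injMaps n N _)))))
            (trans (*-congˡ (*-congˡ (*-distribˡ-∑ _ (allFuns n N) _)))
              (trans (*-congˡ (*-distribˡ-∑ _ (allFuns n N) _)) (*-distribˡ-∑ _ (allFuns n N) _))))))

    rhs-expand : (T : Fin n → (Fin n → Fin N) → (Fin n → Fin N) → Carrier) (ff : Fin n → Fin N × Fin N → Carrier) →
      (∀ s u v → ff s (u , v) ≈ (y 𝒵 z u v r * y 𝒵 z u v s) *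
        ∑ (filter (λ j → j r ≟ u) (filter (λ j → j s ≟ v) (injMaps n N))) (λ j →
          ∑ (filter (λ k → k r ≟ u) (injMaps n N)) (T s j))) →
      ∑ (filter (λ s → ¬? (s ≟ r)) (allFin n)) (λ s → ∑ (distinctPairs N) (ff s))
      ≈ ∑ₛᵤᵥⱼₖ (λ s u v j k → ⟪ not (s == r) ⟫ * (weight s u v j k * T s j k))
    rhs-expand T ff ff-def = trans (∑-filter _ (allFin n) _) (∑-cong (allFin n) λ s → begin
      ⟪ not (does (s ≟ r)) ⟫ * ∑ (distinctPairs N) (ff s)
        ≈⟨ *-cong (reflexive (cong (λ w → ⟪ not w ⟫) (≡.sym (isYes≗does (s ≟ r))))) (∑-distinctPairs N (ff s)) ⟩
      ⟪ not (s == r) ⟫ * ∑ (allFin N) (λ u → ∑ (allFin N) λ v → ⟪ not (u == v) ⟫ * ff s (u , v))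
        ≈⟨ *-congˡ (∑-cong (allFin N) λ u → ∑-cong (allFin N) λ v → *-congˡ (trans (ff-def s u v) (*-congˡ (∑-restricted-pairs s u v (T s))))) ⟩
      ⟪ not (s == r) ⟫ * ∑ (allFin N) (λ u → ∑ (allFin N) λ v → ⟪ not (u == v) ⟫ * ((y 𝒵 z u v r * y 𝒵 z u v s) *
        ∑ (allFuns n N) λ j → ∑ (allFuns n N) λ k → term s u v j k))
        ≈⟨ *-congˡ (∑-cong (allFin N) λ u → ∑-cong (allFin N) λ v →
             trans (*-congˡ (*-distribˡ-∑₂ _ (allFuns n N) (allFuns n N) _)) (*-distribˡ-∑₂ _ (allFuns n N) (allFuns n N) _)) ⟩
      ⟪ not (s == r) ⟫ * ∑ (allFin N) (λ u → ∑ (allFin N) λ v → ∑ (allFuns n N) λ j → ∑ (allFuns n N) λ k →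
        ⟪ not (u == v) ⟫ * ((y 𝒵 z u v r * y 𝒵 z u v s) * term s u v j k))
        ≈⟨ trans (*-distribˡ-∑₂ _ (allFin N) (allFin N) _) (∑-cong (allFin N) λ u → ∑-cong (allFin N) λ v →
             *-distribˡ-∑₂ _ (allFuns n N) (allFuns n N) _) ⟩
      ∑ (allFin N) (λ u → ∑ (allFin N) λ v → ∑ (allFuns n N) λ j → ∑ (allFuns n N) λ k →
        ⟪ not (s == r) ⟫ * (⟪ not (u == v) ⟫ * ((y 𝒵 z u v r * y 𝒵 z u v s) * term s u v j k)))
        ≈⟨ ∑-cong (allFin N) (λ u → ∑-cong (allFin N) λ v → ∑-cong (allFuns n N) λ j → ∑-cong (allFuns n N) λ k →
             *-congˡ (rearrange s u v j k)) ⟩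
      ∑ (allFin N) (λ u → ∑ (allFin N) λ v → ∑ (allFuns n N) λ j → ∑ (allFuns n N) λ k →
        ⟪ not (s == r) ⟫ * (weight s u v j k * T s j k)) ∎)
      where
      term : Fin n → Fin N → Fin N → (Fin n → Fin N) → (Fin n → Fin N) → Carrier
      term s u v j k = χ j * (⟪ j s == v ⟫ * (⟪ j r == u ⟫ * (χ k * (⟪ k r == u ⟫ * T s j k))))

      rearrange : ∀ s u v j k → ⟪ not (u == v) ⟫ * ((y 𝒵 z u v r * y 𝒵 z u v s) * term s u v j k) ≈ weight s u v j k * T s j k
      rearrange s u v j k = solve 9
        (λ nuv yr ys jru jsv cj kru ck t →
           nuv :* ((yr :* ys) :* (cj :* (jsv :* (jru :* (ck :* (kru :* t)))))) :=
           nuv :* (yr :* ys) :* (cj :* jsv :* jru) :* (ck :* kru) :* t)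
        refl _ _ _ _ _ _ _ _ _

    defectTerm-split : ∀ {R S} → r ∉ R → r ∉ S → ∀ s u v j k →
      ⟪ not (s == r) ⟫ * (weight s u v j k *
        ((𝟙 𝒵 S s * p 𝒵 z j (S ─ ⁅ s ⁆) * p 𝒵 z k R) - (𝟙 𝒵 R s * p 𝒵 z j (R ─ ⁅ s ⁆) * p 𝒵 z k S)))
      ≈ defectTerm S R s u v j k - defectTerm R S s u v j k
    defectTerm-split {R} {S} r∉R r∉S s u v j k =
      trans (*-congˡ (*-congˡ (+-cong (*-congʳ (*-congʳ (𝟙≈⟪lookup⟫ S))) (-‿cong (*-congʳ (*-congʳ (𝟙≈⟪lookup⟫ R)))))))
            split
      where
      𝟙≈⟪lookup⟫ : ∀ X → 𝟙 𝒵 X s ≈ ⟪ lookup X s ⟫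
      𝟙≈⟪lookup⟫ X with lookup X s
      ... | true = sym ι-1
      ... | false = sym ι-0

      split : ⟪ not (s == r) ⟫ * (weight s u v j k *
                ((⟪ lookup S s ⟫ * p 𝒵 z j (S ─ ⁅ s ⁆) * p 𝒵 z k R) - (⟪ lookup R s ⟫ * p 𝒵 z j (R ─ ⁅ s ⁆) * p 𝒵 z k S)))
              ≈ defectTerm S R s u v j k - defectTerm R S s u v j k
      split with s ≟ r
      ... | yes ≡.refl rewrite ∉⇒lookup-false S s r∉S | ∉⇒lookup-false R s r∉R =
        solve 5 (λ w a b c d → con 0ℚ :* (w :* (con 0ℚ :* a :* b :- con 0ℚ :* c :* d))
                               := w :* (con 0ℚ :* a :* b) :- w :* (con 0ℚ :* c :* d)) refl _ _ _ _ _
      ... | no _ =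
        solve 7 (λ w x a b x′ c d → con 1ℚ :* (w :* (x :* a :* b :- x′ :* c :* d))
                                    := w :* (x :* a :* b) :- w :* (x′ :* c :* d)) refl _ _ _ _ _ _ _

    -- The summand over pairs is an arbitrary ff with its defining equation: a pattern-matching
    -- λ written out again is a new definition, not definitionally equal to the theorem's.
    rhs≈defects : ∀ {R S} → r ∉ R → r ∉ S → (ff : Fin n → Fin N × Fin N → Carrier) →
      (∀ s u v → ff s (u , v) ≈ (y 𝒵 z u v r * y 𝒵 z u v s) *
        ∑ (filter (λ j → j r ≟ u) (filter (λ j → j s ≟ v) (injMaps n N))) (λ j →
          ∑ (filter (λ k → k r ≟ u) (injMaps n N)) (λ k →
            (𝟙 𝒵 S s * p 𝒵 z j (S ─ ⁅ s ⁆) * p 𝒵 z k R) - (𝟙 𝒵 R s * p 𝒵 z j (R ─ ⁅ s ⁆) * p 𝒵 z k S)))) →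
      ∑ (filter (λ s → ¬? (s ≟ r)) (allFin n)) (λ s → ∑ (distinctPairs N) (ff s))
      ≈ defectPart S R - defectPart R S
    rhs≈defects {R} {S} r∉R r∉S ff ff-def = begin
      ∑ (filter (λ s → ¬? (s ≟ r)) (allFin n)) (λ s → ∑ (distinctPairs N) (ff s))
        ≈⟨ rhs-expand _ ff ff-def ⟩
      ∑ₛᵤᵥⱼₖ (λ s u v j k → ⟪ not (s == r) ⟫ * (weight s u v j k *
        ((𝟙 𝒵 S s * p 𝒵 z j (S ─ ⁅ s ⁆) * p 𝒵 z k R) - (𝟙 𝒵 R s * p 𝒵 z j (R ─ ⁅ s ⁆) * p 𝒵 z k S))))
        ≈⟨ ∑ₛᵤᵥⱼₖ-cong (defectTerm-split r∉R r∉S) ⟩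
      ∑ₛᵤᵥⱼₖ (λ s u v j k → defectTerm S R s u v j k - defectTerm R S s u v j k)
        ≈⟨ ∑ₛᵤᵥⱼₖ-distrib-− _ _ ⟩
      ∑ₛᵤᵥⱼₖ (defectTerm S R) - ∑ₛᵤᵥⱼₖ (defectTerm R S)
        ≈⟨ +-cong (defectPart-expand S R) (-‿cong (defectPart-expand R S)) ⟨
      defectPart S R - defectPart R S ∎

theorem3p3 : {c ℓ : Level} (𝒵 : QAlgebra c ℓ) (N n : ℕ) → 1 ≤ n → n ≤ N →
    (z : Fin N → Fin n → QAlgebra.Carrier 𝒵) (R S : Subset n) (r : Fin n) →
    r ∉ R → r ∉ S →
    let open QAlgebra 𝒵 in
    (pbar 𝒵 z (R ∪ ⁅ r ⁆) * pbar 𝒵 z S) - (pbar 𝒵 z R * pbar 𝒵 z (S ∪ ⁅ r ⁆))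
    ≈ ι ½ * Σ[_]_ 𝒵 (filter (λ s → ¬? (s Data.Fin.≟ r)) (allFin n)) (λ s →
        Σ[_]_ 𝒵 (distinctPairs N) (λ { (u , v) →
          (y 𝒵 z u v r * y 𝒵 z u v s) *
          Σ[_]_ 𝒵 (filter (λ j → j r Data.Fin.≟ u) (filter (λ j → j s Data.Fin.≟ v) (injMaps n N))) (λ j →
            Σ[_]_ 𝒵 (filter (λ k → k r Data.Fin.≟ u) (injMaps n N)) (λ k →
              (𝟙 𝒵 S s * p 𝒵 z j (S ─ ⁅ s ⁆) * p 𝒵 z k R)
              - (𝟙 𝒵 R s * p 𝒵 z j (R ─ ⁅ s ⁆) * p 𝒵 z k S))) }))
theorem3p3 𝒵 N n _ _ z R S r r∉R r∉S =
  trans (lhs≈½defects r∉R r∉S) (*-congˡ (sym (rhs≈defects r∉R r∉S _ (λ _ _ _ → refl))))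
  where
  open QAlgebra 𝒵
  open Expansion 𝒵 z
  open AtPosition r
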